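{- For $k\geq 2$ and integers $n$, let $d_k(n)=p_k(n)-p_k(n-1)$. Then: (1) $d_2(n)=1$ when $n$ is even and $d_2(n)=-1$ when $n$ is odd. (2) $d_3(n)=1$ when $n\equiv 0,2\pmod 6$, $d_3(n)=-1$ when $n\equiv 1\pmod 6$, and $d_3(n)=0$ when $n\equiv 3,4,5\pmod 6$. (3) $d_4(n)\geq 0$ when $n$ is even; $d_4(n)=-\lfloor (n+11)/12\rfloor$ when $n$ is odd and $n\not\equiv 3\pmod{12}$; and $d_4(n)=-\lfloor n/12\rfloor$ when $n\equiv 3\pmod{12}$. (4) $d_5(n)\geq 0$ for $n\geq 2$, and $d_5(n)\geq 1$ for $n\geq 14$. (5) $d_6(n)\geq 0$ for $n\geq 14$. (6) For $k\geq 7$, $d_k(n)\geq 0$ for all $n\geq 2$; moreover $d_k(k+2)\geq 1$ and $d_k(2k+7)\geq 1$.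
   Context: For $k\geq 2$, $p_k(n)$ denotes the number of partitions of $n$ with at most $k$ parts in which the largest part appears at least twice; $p_k(0)=1$ and $p_k(n)=0$ for $n=1$ or $n<0$. Equivalently $\sum_{n\geq0}p_k(n)q^n=1/(q^2;q)_{k-1}$ with $(a;q)_j=\prod_{i=0}^{j-1}(1-aq^i)$. Statements are for nonnegative integers $n$. -}

module Defs where

open import Data.Bool using (Bool; true; false; _∧_)
open import Data.Nat using (ℕ; zero; suc; _≤ᵇ_; _≡ᵇ_)
open import Data.List using (List; []; _∷_; length; map; concatMap; applyUpTo; upTo; filterᵇ)
open import Data.Integer using (ℤ; +_; _-_)
open import Data.Nat.ListAction using (sum)

nonincr : List ℕ → Bool
nonincr []           = true
nonincr (x ∷ [])     = true
nonincr (x ∷ y ∷ xs) = (y ≤ᵇ x) ∧ nonincr (y ∷ xs)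

allPos : List ℕ → Bool
allPos []       = true
allPos (zero ∷ xs)  = false
allPos (suc _ ∷ xs) = allPos xs

-- For a nonincreasing list, "the largest part appears at least twice":
-- the first two entries are equal.  The empty partition (of 0) is counted,
-- matching the convention p_k(0) = 1.
largestTwice : List ℕ → Bool
largestTwice []           = true
largestTwice (x ∷ [])     = false
largestTwice (x ∷ y ∷ xs) = x ≡ᵇ y

good : ℕ → ℕ → List ℕ → Bool
good k n xs = nonincr xs ∧ allPos xs ∧ (sum xs ≡ᵇ n) ∧ (length xs ≤ᵇ k) ∧ largestTwice xs

listsOfLen : ℕ → ℕ → List (List ℕ)
listsOfLen m zero    = [] ∷ []
listsOfLen m (suc L) = concatMap (λ x → map (x ∷_) (listsOfLen m L)) (applyUpTo suc m)

-- every partition of n occurs exactly once among these candidates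
-- (length ≤ n, entries in {1,…,n})
candidates : ℕ → List (List ℕ)
candidates n = concatMap (listsOfLen n) (upTo (suc n))

p : ℕ → ℕ → ℕ
p k n = length (filterᵇ (good k n) (candidates n))

-- d_k(n) = p_k(n) - p_k(n-1), with p_k(-1) = 0
d : ℕ → ℕ → ℤ
d k zero    = + p k zero
d k (suc n) = + p k (suc n) - + p k n

module Submission where

-- Apart from the empty partition, a partition whose largest part repeats has L + 2 ≥ 2 parts.
-- Lowering every part by one maps those of L + 2 + m with exactly L + 2 parts bijectively onto
-- those of m with at most L + 2 parts, i.e. p_k − p_{k−1} = q^k p_k as in
-- 1/(q²;q)_{k−1} − 1/(q²;q)_{k−2} = q^k/(q²;q)_{k−1}.  Taking differences,
--   d_k(n) = d_{k−1}(n) for n < k,    d_k(k + m) = d_{k−1}(k + m) + d_k(m).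
-- As d_1 = 1, −1, 0, 0, …, this makes d_2 2-periodic and d_3 6-periodic, and d_4 changes by a
-- 2-periodic amount every 12 steps.  For k = 5, 6, 7 the recursion gives d_k(n) ≤ d_k(n + c) on a
-- tail, so lower bounds spread from a window of values, which are evaluated.  For k ≥ 8, induction
-- on k carries "d_k ≥ 0 from 2 on and d_k ≥ 1 from 8 on, except at k + 1", the exception coming
-- from d_k(1) = −1.

open import Data.Bool using (Bool; true; false; _∧_)
open import Data.Bool.Properties using (∧-zeroʳ; ∧-identityʳ)
open import Data.Integer as ℤ using (ℤ; +_; -_; +≤+) renaming (_≤_ to _≤ℤ_)
import Data.Integer.Properties as ℤ
import Data.Integer.Tactic.RingSolver as ℤ-Solver
open import Data.List using (List; []; _∷_; length; map; concatMap; applyUpTo; upTo; filterᵇ; _++_)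
open import Data.Nat
open import Data.Nat.DivMod using (m≡m%n+[m/n]*n; m%n<n; %-remove-+ˡ; +-distrib-/-∣ˡ; m*n/n≡m)
open import Data.Nat.Divisibility using (divides; n∣m*n; ∣-trans)
open import Data.Nat.Induction using (<-rec)
open import Data.Nat.ListAction using (sum)
open import Data.Nat.Properties
open import Data.Product using (_×_; _,_; proj₁; proj₂; ∃-syntax)
open import Data.Sum using (_⊎_; inj₁; inj₂)
open import Function using (_∘_; id)
open import Relation.Binary.PropositionalEquality
open import Relation.Nullary using (yes; no; contradiction)
open import Relation.Nullary.Decidable using (dec-true; dec-false; from-yes; _→-dec_; _×-dec_; ¬?)

open import Algebra.Properties.CommutativeSemigroup +-commutativeSemigroup using (interchange; x∙yz≈y∙xz)
open import Algebra.Properties.CommutativeSemigroup ℤ.+-commutativeSemigroup using ()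
  renaming (interchange to ℤ-interchange)

open import Defs

∑ : (ℕ → ℕ) → ℕ → ℕ
∑ f zero    = 0
∑ f (suc n) = f 0 + ∑ (f ∘ suc) n

∑-cong : ∀ {f g} n → (∀ i → i < n → f i ≡ g i) → ∑ f n ≡ ∑ g n
∑-cong zero    eq = refl
∑-cong (suc n) eq = cong₂ _+_ (eq 0 z<s) (∑-cong n (λ i i<n → eq (suc i) (s<s i<n)))

∑-zero : ∀ {f} n → (∀ i → i < n → f i ≡ 0) → ∑ f n ≡ 0
∑-zero zero    eq = refl
∑-zero (suc n) eq = cong₂ _+_ (eq 0 z<s) (∑-zero n (λ i i<n → eq (suc i) (s<s i<n)))

∑-last : ∀ f n → ∑ f (suc n) ≡ ∑ f n + f n
∑-last f zero    = +-comm (f 0) 0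
∑-last f (suc n) = trans (cong (λ u → f 0 + u) (∑-last (f ∘ suc) n)) (sym (+-assoc (f 0) _ _))

∑-+ : ∀ f g n → ∑ (λ i → f i + g i) n ≡ ∑ f n + ∑ g n
∑-+ f g zero    = refl
∑-+ f g (suc n) = trans (cong (λ u → f 0 + g 0 + u) (∑-+ (f ∘ suc) (g ∘ suc) n))
                        (interchange (f 0) (g 0) _ _)

∑-swap : ∀ (f : ℕ → ℕ → ℕ) m n → ∑ (λ i → ∑ (f i) n) m ≡ ∑ (λ j → ∑ (λ i → f i j) m) n
∑-swap f zero    n = sym (∑-zero n (λ _ _ → refl))
∑-swap f (suc m) n = trans (cong (λ u → ∑ (f 0) n + u) (∑-swap (f ∘ suc) m n))
                           (sym (∑-+ (f 0) (λ j → ∑ (λ i → f (suc i) j) m) n))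

∑-vanishing-tail : ∀ {f} m n → m ≤ n → (∀ i → m ≤ i → f i ≡ 0) → ∑ f n ≡ ∑ f m
∑-vanishing-tail zero    n       _         eq = ∑-zero n (λ i _ → eq i z≤n)
∑-vanishing-tail (suc m) (suc n) (s≤s m≤n) eq =
  cong (λ u → _ + u) (∑-vanishing-tail m n m≤n (λ i m≤i → eq (suc i) (s≤s m≤i)))

∑-single : ∀ {f} n i → i < n → (∀ j → j ≢ i → f j ≡ 0) → ∑ f n ≡ f i
∑-single (suc n) zero    _         eq =
  trans (cong (λ u → _ + u) (∑-zero n (λ j _ → eq (suc j) (λ ())))) (+-identityʳ _)
∑-single (suc n) (suc i) (s≤s i<n) eq =
  cong₂ _+_ (eq 0 (λ ())) (∑-single n i i<n (λ j j≢i → eq (suc j) (j≢i ∘ suc-injective)))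

guard : ℕ → ℕ → (ℕ → ℕ) → ℕ
guard a n f with a ≤? n
... | yes _ = f (n ∸ a)
... | no  _ = 0

guard-≤ : ∀ {a n} f → a ≤ n → guard a n f ≡ f (n ∸ a)
guard-≤ {a} {n} f a≤n with a ≤? n
... | yes _   = refl
... | no  a≰n = contradiction a≤n a≰n

guard-> : ∀ {a n} f → n < a → guard a n f ≡ 0
guard-> {a} {n} f n<a with a ≤? n
... | yes a≤n = contradiction a≤n (<⇒≱ n<a)
... | no  _   = refl

guard-+ : ∀ a t f → guard a (a + t) f ≡ f t
guard-+ a t f = trans (guard-≤ f (m≤m+n a t)) (cong f (m+n∸m≡n a t))

guard-zero : ∀ {a n} f → (a ≤ n → f (n ∸ a) ≡ 0) → guard a n f ≡ 0
guard-zero {a} {n} f eq with a ≤? n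
... | yes a≤n = eq a≤n
... | no  _   = refl

∑-guard : ∀ a n (f : ℕ → ℕ → ℕ) m → ∑ (λ j → guard a n (f j)) m ≡ guard a n (λ s → ∑ (λ j → f j s) m)
∑-guard a n f m with a ≤? n
... | yes _ = refl
... | no  _ = ∑-zero m (λ _ _ → refl)

guard-shift : ∀ c a n L {g h : ℕ → ℕ} → (∀ s → s < L → g s ≡ 0) → (∀ t → g (L + t) ≡ h t) →
              guard (c + a) (c + (L + n)) g ≡ guard a n h
guard-shift c a n L {g} {h} small shifted with a ≤? n
... | yes a≤n = begin
  guard (c + a) (c + (L + n)) g            ≡⟨ cong (λ x → guard (c + a) x g) regroup ⟩
  guard (c + a) (c + a + (L + (n ∸ a))) g  ≡⟨ guard-+ (c + a) _ g ⟩
  g (L + (n ∸ a))                          ≡⟨ shifted (n ∸ a) ⟩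
  h (n ∸ a)                                ∎
  where
  open ≡-Reasoning
  regroup : c + (L + n) ≡ c + a + (L + (n ∸ a))
  regroup = sym (begin
    c + a + (L + (n ∸ a))   ≡⟨ +-assoc c a _ ⟩
    c + (a + (L + (n ∸ a))) ≡⟨ cong (λ x → c + (a + x)) (sym (+-∸-assoc L a≤n)) ⟩
    c + (a + (L + n ∸ a))   ≡⟨ cong (λ u → c + u) (m+[n∸m]≡n (≤-trans a≤n (m≤n+m n L))) ⟩
    c + (L + n)             ∎)
... | no  a≰n = guard-zero g (λ ca≤cLn → small _ (below ca≤cLn))
  where
  below : c + a ≤ c + (L + n) → c + (L + n) ∸ (c + a) < L
  below ca≤cLn rewrite [m+n]∸[m+o]≡n∸o c (L + n) a =
    +-cancelˡ-< a _ L (begin-strict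
      a + (L + n ∸ a) ≡⟨ m+[n∸m]≡n (+-cancelˡ-≤ c a (L + n) ca≤cLn) ⟩
      L + n           <⟨ +-monoʳ-< L (≰⇒> a≰n) ⟩
      L + a           ≡⟨ +-comm L a ⟩
      a + L           ∎)
    where open ≤-Reasoning

𝟙 : Bool → ℕ
𝟙 true  = 1
𝟙 false = 0

count : {A : Set} → (A → Bool) → List A → ℕ
count P []       = 0
count P (x ∷ xs) = 𝟙 (P x) + count P xs

length-filterᵇ : {A : Set} (P : A → Bool) (xs : List A) → length (filterᵇ P xs) ≡ count P xs
length-filterᵇ P []       = refl
length-filterᵇ P (x ∷ xs) with P x
... | true  = cong suc (length-filterᵇ P xs)
... | false = length-filterᵇ P xs

count-++ : {A : Set} (P : A → Bool) (xs ys : List A) → count P (xs ++ ys) ≡ count P xs + count P ys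
count-++ P []       ys = refl
count-++ P (x ∷ xs) ys = trans (cong (λ u → 𝟙 (P x) + u) (count-++ P xs ys)) (sym (+-assoc (𝟙 (P x)) _ _))

count-concatMap : {A B : Set} (P : B → Bool) (f : A → List B) (xs : List A) →
                  count P (concatMap f xs) ≡ sum (map (count P ∘ f) xs)
count-concatMap P f []       = refl
count-concatMap P f (x ∷ xs) =
  trans (count-++ P (f x) (concatMap f xs)) (cong (λ u → count P (f x) + u) (count-concatMap P f xs))

count-map : {A B : Set} (P : B → Bool) (g : A → B) (xs : List A) → count P (map g xs) ≡ count (P ∘ g) xs
count-map P g []       = refl
count-map P g (x ∷ xs) = cong (λ u → 𝟙 (P (g x)) + u) (count-map P g xs)

sum-applyUpTo : ∀ (h : ℕ → ℕ) f m → sum (map h (applyUpTo f m)) ≡ ∑ (h ∘ f) m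
sum-applyUpTo h f zero    = refl
sum-applyUpTo h f (suc m) = cong (λ u → h (f 0) + u) (sum-applyUpTo h (f ∘ suc) m)

#lists : ℕ → ℕ → (List ℕ → Bool) → ℕ
#lists m L P = count P (listsOfLen m L)

#lists-suc : ∀ m L P → #lists m (suc L) P ≡ ∑ (λ i → #lists m L (P ∘ (suc i ∷_))) m
#lists-suc m L P = begin
  count P (concatMap (λ x → map (x ∷_) (listsOfLen m L)) (applyUpTo suc m))
    ≡⟨ count-concatMap P _ (applyUpTo suc m) ⟩
  sum (map (λ x → count P (map (x ∷_) (listsOfLen m L))) (applyUpTo suc m))
    ≡⟨ sum-applyUpTo _ suc m ⟩
  ∑ (λ i → count P (map (suc i ∷_) (listsOfLen m L))) m
    ≡⟨ ∑-cong m (λ i _ → count-map P (suc i ∷_) (listsOfLen m L)) ⟩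
  ∑ (λ i → #lists m L (P ∘ (suc i ∷_))) m ∎
  where open ≡-Reasoning

#lists-cong : ∀ m L {P Q} → (∀ ys → allPos ys ≡ true → length ys ≡ L → P ys ≡ Q ys) →
              #lists m L P ≡ #lists m L Q
#lists-cong m zero    eq = cong (λ b → 𝟙 b + 0) (eq [] refl refl)
#lists-cong m (suc L) {P} {Q} eq = begin
  #lists m (suc L) P
    ≡⟨ #lists-suc m L P ⟩
  ∑ (λ i → #lists m L (P ∘ (suc i ∷_))) m
    ≡⟨ ∑-cong m (λ i _ → #lists-cong m L (λ ys pos len → eq (suc i ∷ ys) pos (cong suc len))) ⟩
  ∑ (λ i → #lists m L (Q ∘ (suc i ∷_))) m
    ≡⟨ #lists-suc m L Q ⟨
  #lists m (suc L) Q ∎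
  where open ≡-Reasoning

#lists-none : ∀ m L {P} → (∀ ys → allPos ys ≡ true → length ys ≡ L → P ys ≡ false) → #lists m L P ≡ 0
#lists-none m L {P} rejects = trans (#lists-cong m L rejects) (count-false (listsOfLen m L))
  where
  count-false : (xss : List (List ℕ)) → count (λ _ → false) xss ≡ 0
  count-false []         = refl
  count-false (_ ∷ xss) = count-false xss

+-≡ᵇ-≤ : ∀ a x s → a ≤ s → (a + x ≡ᵇ s) ≡ (x ≡ᵇ s ∸ a)
+-≡ᵇ-≤ zero    x s       _         = refl
+-≡ᵇ-≤ (suc a) x (suc s) (s≤s a≤s) = +-≡ᵇ-≤ a x s a≤s

+-≡ᵇ-> : ∀ a x s → s < a → (a + x ≡ᵇ s) ≡ false
+-≡ᵇ-> (suc a) x zero    _         = refl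
+-≡ᵇ-> (suc a) x (suc s) (s≤s s<a) = +-≡ᵇ-> a x s s<a

#lists-guard : ∀ m L a n (Q : List ℕ → Bool) {g} →
               (∀ s → #lists m L (λ ys → Q ys ∧ (sum ys ≡ᵇ s)) ≡ g s) →
               #lists m L (λ ys → Q ys ∧ (a + sum ys ≡ᵇ n)) ≡ guard a n g
#lists-guard m L a n Q eq with a ≤? n
... | yes a≤n = trans (#lists-cong m L (λ ys _ _ → cong (Q ys ∧_) (+-≡ᵇ-≤ a (sum ys) n a≤n))) (eq (n ∸ a))
... | no  a≰n = #lists-none m L (λ ys _ _ →
                  trans (cong (Q ys ∧_) (+-≡ᵇ-> a (sum ys) n (≰⇒> a≰n))) (∧-zeroʳ (Q ys)))

descendingFrom : ℕ → List ℕ → Bool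
descendingFrom b []       = true
descendingFrom b (y ∷ ys) = (y ≤ᵇ b) ∧ descendingFrom y ys

nonincr-∷ : ∀ x ys → nonincr (x ∷ ys) ≡ descendingFrom x ys
nonincr-∷ x []       = refl
nonincr-∷ x (y ∷ ys) = cong ((y ≤ᵇ x) ∧_) (nonincr-∷ y ys)

-- The number of partitions of s into exactly L parts, each at most b; the recursion fixes the
-- largest part, suc i.
#parts : ℕ → ℕ → ℕ → ℕ
#parts zero    b s = 𝟙 (s ≡ᵇ 0)
#parts (suc L) b s = ∑ (λ i → guard (suc i) s (#parts L (suc i))) b

#parts-small : ∀ L b s → s < L → #parts L b s ≡ 0
#parts-small (suc L) b s s<1+L = ∑-zero b (λ i _ → guard-zero (#parts L (suc i)) (λ 1+i≤s →
  #parts-small L (suc i) (s ∸ suc i) (<-≤-trans (∸-monoʳ-< z<s 1+i≤s) (s≤s⁻¹ s<1+L))))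

#lists-descendingFrom : ∀ m L b s → b ≤ m →
                        #lists m L (λ ys → descendingFrom b ys ∧ (sum ys ≡ᵇ s)) ≡ #parts L b s
#lists-descendingFrom m zero    b zero    _   = refl
#lists-descendingFrom m zero    b (suc s) _   = refl
#lists-descendingFrom m (suc L) b s       b≤m = begin
  #lists m (suc L) P
    ≡⟨ #lists-suc m L P ⟩
  ∑ (λ i → #lists m L (P ∘ (suc i ∷_))) m
    ≡⟨ ∑-vanishing-tail b m b≤m (λ i b≤i → #lists-none m L (λ ys _ _ → tooLarge i ys b≤i)) ⟩
  ∑ (λ i → #lists m L (P ∘ (suc i ∷_))) b
    ≡⟨ ∑-cong b allowed ⟩
  #parts (suc L) b s ∎
  where
  open ≡-Reasoning
  P : List ℕ → Bool
  P ys = descendingFrom b ys ∧ (sum ys ≡ᵇ s)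
  tooLarge : ∀ i ys → b ≤ i → P (suc i ∷ ys) ≡ false
  tooLarge i ys b≤i rewrite dec-false (suc i ≤? b) (<⇒≱ (s≤s b≤i)) = refl
  allowed : ∀ i → i < b → #lists m L (P ∘ (suc i ∷_)) ≡ guard (suc i) s (#parts L (suc i))
  allowed i i<b rewrite dec-true (suc i ≤? b) i<b =
    #lists-guard m L (suc i) s (descendingFrom (suc i))
                 (λ s′ → #lists-descendingFrom m L (suc i) s′ (≤-trans i<b b≤m))

good-rejects : ∀ k n xs → largestTwice xs ≡ false → good k n xs ≡ false
good-rejects k n xs notTwice
  rewrite notTwice | ∧-zeroʳ (length xs ≤ᵇ k) | ∧-zeroʳ (sum xs ≡ᵇ n) | ∧-zeroʳ (allPos xs) =
  ∧-zeroʳ (nonincr xs)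

good-twin : ∀ k n a ys → allPos ys ≡ true →
            good k n (suc a ∷ suc a ∷ ys) ≡
              descendingFrom (suc a) ys ∧ ((suc a + (suc a + sum ys) ≡ᵇ n) ∧ (2 + length ys ≤ᵇ k))
good-twin k n a ys pos
  rewrite dec-true (suc a ≤? suc a) ≤-refl | nonincr-∷ (suc a) ys | pos | dec-true (a ≟ a) refl =
  cong (descendingFrom (suc a) ys ∧_) (cong ((suc a + (suc a + sum ys) ≡ᵇ n) ∧_) (∧-identityʳ _))

-- The number of partitions of n into exactly L + 2 parts whose two largest parts are equal
-- (to suc i in the i-th summand).
#twinTop : ℕ → ℕ → ℕ
#twinTop L n = ∑ (λ i → guard (suc i + suc i) n (#parts L (suc i))) n

#twinTop-small : ∀ L n → n ≤ suc L → #twinTop L n ≡ 0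
#twinTop-small L n n≤1+L = ∑-zero n (λ i _ → guard-zero {suc i + suc i} (#parts L (suc i)) (λ twice≤n →
  #parts-small L (suc i) _ (s≤s⁻¹ (begin
    2 + (n ∸ (suc i + suc i))               ≤⟨ +-monoˡ-≤ _ (+-mono-≤ (s≤s z≤n) (s≤s z≤n)) ⟩
    suc i + suc i + (n ∸ (suc i + suc i))   ≡⟨ m+[n∸m]≡n twice≤n ⟩
    n                                       ≤⟨ n≤1+L ⟩
    suc L                                   ∎))))
  where open ≤-Reasoning

#lists-good-twins : ∀ k n L →
  #lists n (2 + L) (good k n) ≡ ∑ (λ i → #lists n L (λ ys → good k n (suc i ∷ suc i ∷ ys))) n
#lists-good-twins k n L = trans (#lists-suc n (suc L) (good k n)) (∑-cong n (λ i i<n →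
  trans (#lists-suc n L _) (∑-single n i i<n (λ j j≢i → #lists-none n L (λ ys _ _ →
    good-rejects k n (suc i ∷ suc j ∷ ys) (dec-false (i ≟ j) (j≢i ∘ sym)))))))

#lists-good-fits : ∀ k n L → 2 + L ≤ k → #lists n (2 + L) (good k n) ≡ #twinTop L n
#lists-good-fits k n L fits = trans (#lists-good-twins k n L) (∑-cong n (λ i i<n →
  trans (#lists-cong n L (λ ys pos len → trans (good-twin k n i ys pos) (regroup i ys len)))
        (#lists-guard n L (suc i + suc i) n (descendingFrom (suc i))
                      (λ s → #lists-descendingFrom n L (suc i) s i<n))))
  where
  regroup : ∀ i ys → length ys ≡ L →
    descendingFrom (suc i) ys ∧ ((suc i + (suc i + sum ys) ≡ᵇ n) ∧ (2 + length ys ≤ᵇ k)) ≡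
      descendingFrom (suc i) ys ∧ (suc i + suc i + sum ys ≡ᵇ n)
  regroup i ys refl rewrite dec-true (2 + length ys ≤? k) fits | +-assoc (suc i) (suc i) (sum ys) =
    cong (descendingFrom (suc i) ys ∧_) (∧-identityʳ _)

#lists-good-tooLong : ∀ k n L → k < 2 + L → #lists n (2 + L) (good k n) ≡ 0
#lists-good-tooLong k n L tooLong = trans (#lists-good-twins k n L) (∑-zero n (λ i _ →
  #lists-none n L (λ ys pos len → trans (good-twin k n i ys pos) (rejected i ys len))))
  where
  rejected : ∀ i ys → length ys ≡ L →
    descendingFrom (suc i) ys ∧ ((suc i + (suc i + sum ys) ≡ᵇ n) ∧ (2 + length ys ≤ᵇ k)) ≡ false
  rejected i ys refl
    rewrite dec-false (2 + length ys ≤? k) (<⇒≱ tooLong) | ∧-zeroʳ (suc i + (suc i + sum ys) ≡ᵇ n) =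
    ∧-zeroʳ _

#lists-good-singleton : ∀ k n m → #lists m 1 (good k n) ≡ 0
#lists-good-singleton k n m = #lists-none m 1 single
  where
  single : ∀ ys → allPos ys ≡ true → length ys ≡ 1 → good k n ys ≡ false
  single (x ∷ []) _ _ = good-rejects k n (x ∷ []) refl

-- At most k parts: the empty partition, and exactly L + 2 parts with L + 2 ≤ k.
P : ℕ → ℕ → ℕ
P k n = 𝟙 (n ≡ᵇ 0) + ∑ (λ L → #twinTop L n) (k ∸ 1)

p≡∑#lists : ∀ k n → p k n ≡ ∑ (λ L → #lists n L (good k n)) (suc n)
p≡∑#lists k n = trans (length-filterᵇ (good k n) (candidates n))
  (trans (count-concatMap (good k n) (listsOfLen n) (upTo (suc n))) (sum-applyUpTo _ id (suc n)))

p≡P : ∀ k n → p (suc k) n ≡ P (suc k) n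
p≡P k zero    = trans (p≡∑#lists (suc k) 0) (cong (λ u → 1 + u) (sym (∑-zero k (λ _ _ → refl))))
p≡P k (suc n) = trans (p≡∑#lists (suc k) (suc n)) (cong₂ _+_ (#lists-good-singleton (suc k) (suc n) (suc n)) (begin
  ∑ lists n                ≡⟨ ∑-vanishing-tail n (n + k) (m≤m+n n k) beyond-n ⟨
  ∑ lists (n + k)          ≡⟨ cong (∑ lists) (+-comm n k) ⟩
  ∑ lists (k + n)          ≡⟨ ∑-vanishing-tail k (k + n) (m≤m+n k n) beyond-k ⟩
  ∑ lists k                ≡⟨ ∑-cong k (λ L L<k → #lists-good-fits (suc k) (suc n) L (s≤s L<k)) ⟩
  ∑ (λ L → #twinTop L (suc n)) k ∎))
  where
  open ≡-Reasoning
  lists : ℕ → ℕ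
  lists L = #lists (suc n) (2 + L) (good (suc k) (suc n))
  beyond-k : ∀ L → k ≤ L → lists L ≡ 0
  beyond-k L k≤L = #lists-good-tooLong (suc k) (suc n) L (s≤s (s≤s k≤L))
  beyond-n : ∀ L → n ≤ L → lists L ≡ 0
  beyond-n L n≤L with L <? k
  ... | yes L<k = trans (#lists-good-fits (suc k) (suc n) L (s≤s L<k)) (#twinTop-small L (suc n) (s≤s n≤L))
  ... | no  L≮k = beyond-k L (≮⇒≥ L≮k)

#partsAtMost : ℕ → ℕ → ℕ → ℕ
#partsAtMost L b s = ∑ (λ j → #parts j b s) (suc L)

#partsAtMost-zero : ∀ L s → #partsAtMost L 0 s ≡ 𝟙 (s ≡ᵇ 0)
#partsAtMost-zero L s = trans (cong (λ u → 𝟙 (s ≡ᵇ 0) + u) (∑-zero L (λ _ _ → refl))) (+-identityʳ _)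

#partsAtMost-suc : ∀ L b s →
  #partsAtMost (suc L) b s ≡ 𝟙 (s ≡ᵇ 0) + ∑ (λ i → guard (suc i) s (#partsAtMost L (suc i))) b
#partsAtMost-suc L b s = cong (λ u → 𝟙 (s ≡ᵇ 0) + u) (trans
  (∑-swap (λ j i → guard (suc i) s (#parts j (suc i))) (suc L) b)
  (∑-cong b (λ i _ → ∑-guard (suc i) s (λ j → #parts j (suc i)) (suc L))))

-- Lower every part by one; the parts equal to 1 disappear.
#parts-shift : ∀ L b s → #parts L (suc b) (L + s) ≡ #partsAtMost L b s
#parts-shift zero    b s = sym (+-identityʳ _)
#parts-shift (suc L) b s = trans (cong₂ _+_ largestOne (∑-cong b (λ i _ → largerParts i)))
                                 (sym (#partsAtMost-suc L b s))
  where
  largestOne : guard 1 (suc (L + s)) (#parts L 1) ≡ 𝟙 (s ≡ᵇ 0)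
  largestOne = trans (guard-+ 1 (L + s) (#parts L 1)) (trans (#parts-shift L 0 s) (#partsAtMost-zero L s))
  largerParts : ∀ i → guard (suc (suc i)) (suc (L + s)) (#parts L (suc (suc i))) ≡
                      guard (suc i) s (#partsAtMost L (suc i))
  largerParts i = guard-shift 1 (suc i) s L (#parts-small L _) (#parts-shift L (suc i))

#twinTop-shift : ∀ L m → #twinTop L (2 + (L + m)) ≡ P (2 + L) m
#twinTop-shift L m = cong₂ _+_ largestOne (begin
  ∑ (λ i → guard (suc (suc i) + suc (suc i)) (2 + (L + m)) (#parts L (suc (suc i)))) (suc (L + m))
    ≡⟨ ∑-cong (suc (L + m)) (λ i _ → largerParts i) ⟩
  ∑ (λ i → guard (suc i + suc i) m (#partsAtMost L (suc i))) (suc (L + m))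
    ≡⟨ ∑-vanishing-tail m (suc (L + m)) (≤-trans (m≤n+m m L) (n≤1+n _)) (λ i m≤i →
         guard-> _ (<-≤-trans (s≤s m≤i) (m≤m+n (suc i) (suc i)))) ⟩
  ∑ (λ i → guard (suc i + suc i) m (#partsAtMost L (suc i))) m
    ≡⟨ ∑-cong m (λ i _ → ∑-guard (suc i + suc i) m (λ j → #parts j (suc i)) (suc L)) ⟨
  ∑ (λ i → ∑ (λ j → guard (suc i + suc i) m (#parts j (suc i))) (suc L)) m
    ≡⟨ ∑-swap (λ i j → guard (suc i + suc i) m (#parts j (suc i))) m (suc L) ⟩
  ∑ (λ j → #twinTop j m) (suc L) ∎)
  where
  open ≡-Reasoning
  largestOne : guard 2 (2 + (L + m)) (#parts L 1) ≡ 𝟙 (m ≡ᵇ 0)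
  largestOne = trans (guard-+ 2 (L + m) (#parts L 1)) (trans (#parts-shift L 0 m) (#partsAtMost-zero L m))
  largerParts : ∀ i → guard (suc (suc i) + suc (suc i)) (2 + (L + m)) (#parts L (suc (suc i))) ≡
                      guard (suc i + suc i) m (#partsAtMost L (suc i))
  largerParts i = trans (cong (λ a → guard a (2 + (L + m)) (#parts L (suc (suc i)))) (cong (suc ∘ suc) (+-suc i (suc i))))
                        (guard-shift 2 (suc i + suc i) m L (#parts-small L _) (#parts-shift L (suc i)))

P-suc : ∀ k n → P (2 + k) n ≡ P (1 + k) n + #twinTop k n
P-suc k n = trans (cong (λ u → 𝟙 (n ≡ᵇ 0) + u) (∑-last (λ L → #twinTop L n) k))
                  (sym (+-assoc (𝟙 (n ≡ᵇ 0)) _ _))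

δ : (ℕ → ℕ) → ℕ → ℤ
δ f zero    = + f zero
δ f (suc n) = + f (suc n) ℤ.- + f n

δ-+ : ∀ {f g h} → (∀ n → f n ≡ g n + h n) → ∀ n → δ f n ≡ δ g n ℤ.+ δ h n
δ-+ split zero    = cong +_ (split 0)
δ-+ {g = g} {h} split (suc n) rewrite split (suc n) | split n =
  differences (+ g (suc n)) (+ h (suc n)) (+ g n) (+ h n)
  where
  differences : ∀ a b c e → (a ℤ.+ b) ℤ.- (c ℤ.+ e) ≡ (a ℤ.- c) ℤ.+ (b ℤ.- e)
  differences = ℤ-Solver.solve-∀

δ-vanishing : ∀ K {f} → (∀ n → n < K → f n ≡ 0) → ∀ n → n < K → δ f n ≡ + 0
δ-vanishing K vanish zero    0<K = cong +_ (vanish 0 0<K)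
δ-vanishing K vanish (suc n) n<K rewrite vanish (suc n) n<K | vanish n (<-trans (n<1+n n) n<K) = refl

δ-shift : ∀ K {f g} → (∀ n → n ≤ K → f n ≡ 0) → (∀ m → f (suc (K + m)) ≡ g m) →
          ∀ m → δ f (suc (K + m)) ≡ δ g m
δ-shift K {g = g} vanish shifted zero
  rewrite shifted 0 | vanish (K + 0) (≤-reflexive (+-identityʳ K)) = ℤ.+-identityʳ (+ g 0)
δ-shift K vanish shifted (suc m)
  rewrite shifted (suc m) | +-suc K m | shifted m = refl

-- Opaque so that conversion checking never unfolds the counting sums in the symbolic arguments
-- below; the finitely many values that are needed are computed under `unfolding Δ`.
opaque
  Δ : ℕ → ℕ → ℤ
  Δ k = δ (P k)

  d≡Δ : ∀ {k} → 0 < k → ∀ n → d k n ≡ Δ k n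
  d≡Δ {suc k} _ zero    = cong +_ (p≡P k 0)
  d≡Δ {suc k} _ (suc n) = cong₂ (λ a b → + a ℤ.- + b) (p≡P k (suc n)) (p≡P k n)

  Δ-below : ∀ k n → n < 2 + k → Δ (2 + k) n ≡ Δ (1 + k) n
  Δ-below k n n<2+k = begin
    Δ (2 + k) n
      ≡⟨ δ-+ {g = P (1 + k)} (P-suc k) n ⟩
    Δ (1 + k) n ℤ.+ δ (#twinTop k) n
      ≡⟨ cong (λ x → Δ (1 + k) n ℤ.+ x) (δ-vanishing (2 + k) twinTop-vanishes n n<2+k) ⟩
    Δ (1 + k) n ℤ.+ + 0
      ≡⟨ ℤ.+-identityʳ _ ⟩
    Δ (1 + k) n ∎
    where
    open ≡-Reasoning
    twinTop-vanishes : ∀ n′ → n′ < 2 + k → #twinTop k n′ ≡ 0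
    twinTop-vanishes n′ n′<2+k = #twinTop-small k n′ (s≤s⁻¹ n′<2+k)

  Δ-above : ∀ k m → Δ (2 + k) (2 + k + m) ≡ Δ (1 + k) (2 + k + m) ℤ.+ Δ (2 + k) m
  Δ-above k m = trans (δ-+ {g = P (1 + k)} (P-suc k) (2 + k + m))
    (cong (λ x → Δ (1 + k) (2 + k + m) ℤ.+ x) (δ-shift (suc k) (#twinTop-small k) (#twinTop-shift k) m))

  Δ-at-0 : ∀ k → Δ (suc k) 0 ≡ + 1
  Δ-at-0 k = cong (λ x → + (1 + x)) (∑-zero k (λ _ _ → refl))

  Δ-at-1 : ∀ k → Δ (suc k) 1 ≡ - + 1
  Δ-at-1 k = cong₂ (λ x y → + x ℤ.- + (1 + y)) (∑-zero k (λ _ _ → refl)) (∑-zero k (λ _ _ → refl))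

  Δ1-vanishes : ∀ m → Δ 1 (2 + m) ≡ + 0
  Δ1-vanishes m = refl

Periodic : {A : Set} → ℕ → (ℕ → A) → Set
Periodic q f = ∀ m → f (q + m) ≡ f m

periodic-+* : ∀ {A : Set} {q} {f : ℕ → A} → Periodic q f → ∀ j m → f (j * q + m) ≡ f m
periodic-+* per zero    m = refl
periodic-+* {q = q} {f} per (suc j) m =
  trans (cong f (+-assoc q (j * q) m)) (trans (per (j * q + m)) (periodic-+* per j m))

m≡[m/n]*n+m%n : ∀ m n .{{_ : NonZero n}} → m ≡ m / n * n + m % n
m≡[m/n]*n+m%n m n = trans (m≡m%n+[m/n]*n m n) (+-comm (m % n) _)

periodic-% : ∀ {A : Set} {q} .{{_ : NonZero q}} {f : ℕ → A} → Periodic q f → ∀ n → f n ≡ f (n % q)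
periodic-% {q = q} {f} per n = trans (cong f (m≡[m/n]*n+m%n n q)) (periodic-+* per (n / q) (n % q))

lower-bound-propagates : ∀ {f : ℕ → ℤ} {c} N q .{{_ : NonZero q}} →
  (∀ m → N ≤ m → f m ≤ℤ f (q + m)) → (∀ {r} → r < q → c ≤ℤ f (N + r)) →
  ∀ n → N ≤ n → c ≤ℤ f n
lower-bound-propagates {f} {c} N q step window n N≤n =
  subst (λ x → c ≤ℤ f x) (sym position) (along (t / q) (m%n<n t q))
  where
  t : ℕ
  t = n ∸ N
  along : ∀ j {r} → r < q → c ≤ℤ f (j * q + (N + r))
  along zero    r<q = window r<q
  along (suc j) {r} r<q = ℤ.≤-trans (along j r<q)
    (subst (λ x → f (j * q + (N + r)) ≤ℤ f x) (sym (+-assoc q (j * q) (N + r)))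
           (step _ (≤-trans (m≤m+n N r) (m≤n+m (N + r) (j * q)))))
  position : n ≡ t / q * q + (N + t % q)
  position = begin
    n                         ≡⟨ m+[n∸m]≡n N≤n ⟨
    N + t                     ≡⟨ cong (λ x → N + x) (m≡[m/n]*n+m%n t q) ⟩
    N + (t / q * q + t % q)   ≡⟨ x∙yz≈y∙xz N (t / q * q) (t % q) ⟩
    t / q * q + (N + t % q)   ∎
    where open ≡-Reasoning

linear-growth : ∀ {f g : ℕ → ℤ} q → (∀ m → f (q + m) ≡ g m ℤ.+ f m) → Periodic q g →
                ∀ j r → f (j * q + r) ≡ + j ℤ.* g r ℤ.+ f r
linear-growth {f} {g} q step per zero    r = sym (ℤ.+-identityˡ (f r))
linear-growth {f} {g} q step per (suc j) r = begin
  f (q + j * q + r)                     ≡⟨ cong f (+-assoc q (j * q) r) ⟩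
  f (q + (j * q + r))                   ≡⟨ step (j * q + r) ⟩
  g (j * q + r) ℤ.+ f (j * q + r)       ≡⟨ cong₂ ℤ._+_ (periodic-+* per j r) (linear-growth q step per j r) ⟩
  g r ℤ.+ (+ j ℤ.* g r ℤ.+ f r)         ≡⟨ one-more (+ j) (g r) (f r) ⟩
  + suc j ℤ.* g r ℤ.+ f r               ∎
  where
  open ≡-Reasoning
  one-more : ∀ a x y → x ℤ.+ (a ℤ.* x ℤ.+ y) ≡ (+ 1 ℤ.+ a) ℤ.* x ℤ.+ y
  one-more = ℤ-Solver.solve-∀

≤-+-nonneg : ∀ {a b} → + 0 ≤ℤ a → b ≤ℤ a ℤ.+ b
≤-+-nonneg {a} {b} 0≤a = subst (λ x → x ≤ℤ a ℤ.+ b) (ℤ.+-identityˡ b) (ℤ.+-monoˡ-≤ b 0≤a)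

[m+n]/d≡m/d+[m%d+n]/d : ∀ m n d .{{_ : NonZero d}} → (m + n) / d ≡ m / d + (m % d + n) / d
[m+n]/d≡m/d+[m%d+n]/d m n d = begin
  (m + n) / d                     ≡⟨ cong (λ x → (x + n) / d) (m≡[m/n]*n+m%n m d) ⟩
  (m / d * d + m % d + n) / d     ≡⟨ cong (_/ d) (+-assoc (m / d * d) (m % d) n) ⟩
  (m / d * d + (m % d + n)) / d   ≡⟨ +-distrib-/-∣ˡ (m % d + n) (n∣m*n (m / d)) ⟩
  m / d * d / d + (m % d + n) / d ≡⟨ cong (λ x → x + (m % d + n) / d) (m*n/n≡m (m / d) d) ⟩
  m / d + (m % d + n) / d         ∎
  where open ≡-Reasoning

n%12%2≡n%2 : ∀ n → n % 12 % 2 ≡ n % 2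
n%12%2≡n%2 n = sym (trans (cong (_% 2) (m≡[m/n]*n+m%n n 12))
                          (%-remove-+ˡ (n % 12) (∣-trans (divides 6 refl) (n∣m*n (n / 12)))))

below-or-above : ∀ K n → n < K ⊎ ∃[ m ] K + m ≡ n
below-or-above K n with n <? K
... | yes n<K = inj₁ n<K
... | no  n≮K = inj₂ (n ∸ K , m+[n∸m]≡n (≮⇒≥ n≮K))

Δ2-periodic : Periodic 2 (Δ 2)
Δ2-periodic m =
  trans (Δ-above 0 m) (trans (cong (λ x → x ℤ.+ Δ 2 m) (Δ1-vanishes m)) (ℤ.+-identityˡ (Δ 2 m)))

Δ2-alternates : ∀ m → Δ 2 m ℤ.+ Δ 2 (1 + m) ≡ + 0
Δ2-alternates zero          = cong₂ ℤ._+_ (Δ-at-0 1) (Δ-at-1 1)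
Δ2-alternates (suc zero)    = cong₂ ℤ._+_ (Δ-at-1 1) (trans (Δ2-periodic 0) (Δ-at-0 1))
Δ2-alternates (suc (suc m)) rewrite Δ2-periodic m | Δ2-periodic (1 + m) = Δ2-alternates m

d2-by-parity : ∀ n → (n % 2 ≡ 0 → d 2 n ≡ + 1) × (n % 2 ≡ 1 → d 2 n ≡ - (+ 1))
d2-by-parity n = (λ even → trans (at even) (Δ-at-0 1)) , (λ odd → trans (at odd) (Δ-at-1 1))
  where
  at : ∀ {r} → n % 2 ≡ r → d 2 n ≡ Δ 2 r
  at refl = trans (d≡Δ z<s n) (periodic-% {q = 2} Δ2-periodic n)

Δ3-periodic : Periodic 6 (Δ 3)
Δ3-periodic m = begin
  Δ 3 (6 + m)
    ≡⟨ Δ-above 1 (3 + m) ⟩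
  Δ 2 (6 + m) ℤ.+ Δ 3 (3 + m)
    ≡⟨ cong₂ ℤ._+_ (periodic-+* {q = 2} {Δ 2} Δ2-periodic 3 m) (Δ-above 1 m) ⟩
  Δ 2 m ℤ.+ (Δ 2 (3 + m) ℤ.+ Δ 3 m)
    ≡⟨ cong (λ x → Δ 2 m ℤ.+ (x ℤ.+ Δ 3 m)) (Δ2-periodic (1 + m)) ⟩
  Δ 2 m ℤ.+ (Δ 2 (1 + m) ℤ.+ Δ 3 m)
    ≡⟨ ℤ.+-assoc (Δ 2 m) _ _ ⟨
  Δ 2 m ℤ.+ Δ 2 (1 + m) ℤ.+ Δ 3 m
    ≡⟨ cong (λ x → x ℤ.+ Δ 3 m) (Δ2-alternates m) ⟩
  + 0 ℤ.+ Δ 3 m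
    ≡⟨ ℤ.+-identityˡ (Δ 3 m) ⟩
  Δ 3 m ∎
  where open ≡-Reasoning

opaque
  unfolding Δ

  Δ3-values : Δ 3 2 ≡ + 1 × Δ 3 3 ≡ + 0 × Δ 3 4 ≡ + 0 × Δ 3 5 ≡ + 0
  Δ3-values = refl , refl , refl , refl

d3-by-residue : ∀ n → ((n % 6 ≡ 0) → d 3 n ≡ + 1) × ((n % 6 ≡ 2) → d 3 n ≡ + 1)
                × ((n % 6 ≡ 1) → d 3 n ≡ - (+ 1))
                × ((n % 6 ≡ 3) → d 3 n ≡ + 0) × ((n % 6 ≡ 4) → d 3 n ≡ + 0) × ((n % 6 ≡ 5) → d 3 n ≡ + 0)
d3-by-residue n = let (at2 , at3 , at4 , at5) = Δ3-values in
    (λ h → trans (at h) (Δ-at-0 2)) , (λ h → trans (at h) at2) , (λ h → trans (at h) (Δ-at-1 2))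
  , (λ h → trans (at h) at3) , (λ h → trans (at h) at4) , (λ h → trans (at h) at5)
  where
  at : ∀ {r} → n % 6 ≡ r → d 3 n ≡ Δ 3 r
  at refl = trans (d≡Δ z<s n) (periodic-% {q = 6} Δ3-periodic n)

Δ4-increment : ℕ → ℤ
Δ4-increment m = Δ 3 m ℤ.+ (Δ 3 (2 + m) ℤ.+ Δ 3 (4 + m))

Δ4-step : ∀ m → Δ 4 (12 + m) ≡ Δ4-increment m ℤ.+ Δ 4 m
Δ4-step m = begin
  Δ 4 (12 + m)
    ≡⟨ Δ-above 2 (8 + m) ⟩
  Δ 3 (12 + m) ℤ.+ Δ 4 (8 + m)
    ≡⟨ cong (λ x → Δ 3 (12 + m) ℤ.+ x) (Δ-above 2 (4 + m)) ⟩
  Δ 3 (12 + m) ℤ.+ (Δ 3 (8 + m) ℤ.+ Δ 4 (4 + m))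
    ≡⟨ cong (λ x → Δ 3 (12 + m) ℤ.+ (Δ 3 (8 + m) ℤ.+ x)) (Δ-above 2 m) ⟩
  Δ 3 (12 + m) ℤ.+ (Δ 3 (8 + m) ℤ.+ (Δ 3 (4 + m) ℤ.+ Δ 4 m))
    ≡⟨ cong₂ (λ x y → x ℤ.+ (y ℤ.+ (Δ 3 (4 + m) ℤ.+ Δ 4 m)))
             (periodic-+* {q = 6} {Δ 3} Δ3-periodic 2 m) (Δ3-periodic (2 + m)) ⟩
  Δ 3 m ℤ.+ (Δ 3 (2 + m) ℤ.+ (Δ 3 (4 + m) ℤ.+ Δ 4 m))
    ≡⟨ cong (λ x → Δ 3 m ℤ.+ x) (ℤ.+-assoc (Δ 3 (2 + m)) _ _) ⟨
  Δ 3 m ℤ.+ (Δ 3 (2 + m) ℤ.+ Δ 3 (4 + m) ℤ.+ Δ 4 m)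
    ≡⟨ ℤ.+-assoc (Δ 3 m) _ _ ⟨
  Δ4-increment m ℤ.+ Δ 4 m ∎
  where open ≡-Reasoning

Δ4-increment-periodic : Periodic 2 Δ4-increment
Δ4-increment-periodic m rewrite Δ3-periodic m =
  trans (sym (ℤ.+-assoc (Δ 3 (2 + m)) _ _)) (ℤ.+-comm _ (Δ 3 m))

opaque
  unfolding Δ

  Δ4-increment-at-0 : Δ4-increment 0 ≡ + 2
  Δ4-increment-at-0 = refl

  Δ4-increment-at-1 : Δ4-increment 1 ≡ - + 1
  Δ4-increment-at-1 = refl

  Δ4-at-3 : Δ 4 3 ≡ + 0
  Δ4-at-3 = refl

  Δ4-even-residues : ∀ {r} → r < 12 → r % 2 ≡ 0 → + 0 ≤ℤ Δ 4 r
  Δ4-even-residues = from-yes (allUpTo? (λ r → (r % 2 ≟ 0) →-dec (+ 0 ℤ.≤? Δ 4 r)) 12)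

  Δ4-odd-residues : ∀ {r} → r < 12 → r % 2 ≡ 1 → r ≢ 3 → Δ 4 r ≡ - + 1 × (r + 11) / 12 ≡ 1
  Δ4-odd-residues = from-yes (allUpTo? (λ r →
    (r % 2 ≟ 1) →-dec ¬? (r ≟ 3) →-dec (Δ 4 r ℤ.≟ - + 1) ×-dec ((r + 11) / 12 ≟ 1)) 12)

Δ4-increment-periodic-12 : Periodic 12 Δ4-increment
Δ4-increment-periodic-12 = periodic-+* {q = 2} {Δ4-increment} Δ4-increment-periodic 6

Δ4-increment-adjacent : ∀ m → Δ4-increment m ℤ.+ Δ4-increment (1 + m) ≡ + 1
Δ4-increment-adjacent zero          = cong₂ ℤ._+_ Δ4-increment-at-0 Δ4-increment-at-1
Δ4-increment-adjacent (suc zero)    =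
  cong₂ ℤ._+_ Δ4-increment-at-1 (trans (Δ4-increment-periodic 0) Δ4-increment-at-0)
Δ4-increment-adjacent (suc (suc m))
  rewrite Δ4-increment-periodic m | Δ4-increment-periodic (1 + m) = Δ4-increment-adjacent m

Δ4-expansion : ∀ j r → Δ 4 (j * 12 + r) ≡ + j ℤ.* Δ4-increment r ℤ.+ Δ 4 r
Δ4-expansion = linear-growth 12 Δ4-step Δ4-increment-periodic-12

Δ4-by-residue : ∀ n → Δ 4 n ≡ + (n / 12) ℤ.* Δ4-increment (n % 2) ℤ.+ Δ 4 (n % 12)
Δ4-by-residue n = begin
  Δ 4 n
    ≡⟨ cong (Δ 4) (m≡[m/n]*n+m%n n 12) ⟩
  Δ 4 (n / 12 * 12 + n % 12)
    ≡⟨ Δ4-expansion (n / 12) (n % 12) ⟩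
  + (n / 12) ℤ.* Δ4-increment (n % 12) ℤ.+ Δ 4 (n % 12)
    ≡⟨ cong (λ x → + (n / 12) ℤ.* x ℤ.+ Δ 4 (n % 12)) sameParity ⟩
  + (n / 12) ℤ.* Δ4-increment (n % 2) ℤ.+ Δ 4 (n % 12) ∎
  where
  open ≡-Reasoning
  sameParity : Δ4-increment (n % 12) ≡ Δ4-increment (n % 2)
  sameParity = trans (sym (periodic-% {q = 12} Δ4-increment-periodic-12 n))
                     (periodic-% {q = 2} Δ4-increment-periodic n)

Δ4-increment-even : ∀ n → n % 2 ≡ 0 → Δ4-increment (n % 2) ≡ + 2
Δ4-increment-even n even = trans (cong Δ4-increment even) Δ4-increment-at-0

Δ4-increment-odd : ∀ n → n % 2 ≡ 1 → Δ4-increment (n % 2) ≡ - + 1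
Δ4-increment-odd n odd = trans (cong Δ4-increment odd) Δ4-increment-at-1

d4-even : ∀ n → n % 2 ≡ 0 → + 0 ≤ℤ d 4 n
d4-even n even = begin
  + 0
    ≤⟨ ℤ.+-mono-≤ (+≤+ z≤n) (Δ4-even-residues (m%n<n n 12) (trans (n%12%2≡n%2 n) even)) ⟩
  + (n / 12 * 2) ℤ.+ Δ 4 (n % 12)
    ≡⟨ cong (λ x → x ℤ.+ Δ 4 (n % 12)) (ℤ.pos-* (n / 12) 2) ⟩
  + (n / 12) ℤ.* + 2 ℤ.+ Δ 4 (n % 12)
    ≡⟨ cong (λ i → + (n / 12) ℤ.* i ℤ.+ Δ 4 (n % 12)) (Δ4-increment-even n even) ⟨
  + (n / 12) ℤ.* Δ4-increment (n % 2) ℤ.+ Δ 4 (n % 12)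
    ≡⟨ Δ4-by-residue n ⟨
  Δ 4 n
    ≡⟨ d≡Δ z<s n ⟨
  d 4 n ∎
  where
  open ℤ.≤-Reasoning

d4-odd : ∀ n → n % 2 ≡ 1 → n % 12 ≢ 3 → d 4 n ≡ - (+ ((n + 11) / 12))
d4-odd n odd not3 = begin
  d 4 n
    ≡⟨ d≡Δ z<s n ⟩
  Δ 4 n
    ≡⟨ Δ4-by-residue n ⟩
  + (n / 12) ℤ.* Δ4-increment (n % 2) ℤ.+ Δ 4 (n % 12)
    ≡⟨ cong₂ (λ i x → + (n / 12) ℤ.* i ℤ.+ x) (Δ4-increment-odd n odd) (proj₁ residue) ⟩
  + (n / 12) ℤ.* - + 1 ℤ.+ - + 1
    ≡⟨ negate (+ (n / 12)) ⟩
  - (+ (n / 12 + 1))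
    ≡⟨ cong (λ x → - (+ x)) quotient ⟨
  - (+ ((n + 11) / 12)) ∎
  where
  open ≡-Reasoning
  residue : Δ 4 (n % 12) ≡ - + 1 × (n % 12 + 11) / 12 ≡ 1
  residue = Δ4-odd-residues (m%n<n n 12) (trans (n%12%2≡n%2 n) odd) not3
  quotient : (n + 11) / 12 ≡ n / 12 + 1
  quotient = trans ([m+n]/d≡m/d+[m%d+n]/d n 11 12) (cong (λ x → n / 12 + x) (proj₂ residue))
  negate : ∀ x → x ℤ.* - + 1 ℤ.+ - + 1 ≡ - (x ℤ.+ + 1)
  negate = ℤ-Solver.solve-∀

d4-three : ∀ n → n % 12 ≡ 3 → d 4 n ≡ - (+ (n / 12))
d4-three n three = begin
  d 4 n
    ≡⟨ d≡Δ z<s n ⟩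
  Δ 4 n
    ≡⟨ Δ4-by-residue n ⟩
  + (n / 12) ℤ.* Δ4-increment (n % 2) ℤ.+ Δ 4 (n % 12)
    ≡⟨ cong₂ (λ i x → + (n / 12) ℤ.* i ℤ.+ x) (Δ4-increment-odd n odd) (trans (cong (Δ 4) three) Δ4-at-3) ⟩
  + (n / 12) ℤ.* - + 1 ℤ.+ + 0
    ≡⟨ negate (+ (n / 12)) ⟩
  - (+ (n / 12)) ∎
  where
  open ≡-Reasoning
  odd : n % 2 ≡ 1
  odd = trans (sym (n%12%2≡n%2 n)) (cong (_% 2) three)
  negate : ∀ x → x ℤ.* - + 1 ℤ.+ + 0 ≡ - x
  negate = ℤ-Solver.solve-∀

Δ5-increment : ℕ → ℤ
Δ5-increment m = Δ 4 (10 + m) ℤ.+ Δ 4 (5 + m)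

Δ5-step : ∀ m → Δ 5 (10 + m) ≡ Δ5-increment m ℤ.+ Δ 5 m
Δ5-step m = trans (Δ-above 3 (5 + m))
  (trans (cong (λ x → Δ 4 (10 + m) ℤ.+ x) (Δ-above 3 m)) (sym (ℤ.+-assoc (Δ 4 (10 + m)) _ _)))

Δ5-increment-step : ∀ m → Δ5-increment (12 + m) ≡ + 1 ℤ.+ Δ5-increment m
Δ5-increment-step m = begin
  Δ 4 (12 + (10 + m)) ℤ.+ Δ 4 (12 + (5 + m))
    ≡⟨ cong₂ ℤ._+_ (Δ4-step (10 + m)) (Δ4-step (5 + m)) ⟩
  Δ4-increment (10 + m) ℤ.+ Δ 4 (10 + m) ℤ.+ (Δ4-increment (5 + m) ℤ.+ Δ 4 (5 + m))
    ≡⟨ ℤ-interchange (Δ4-increment (10 + m)) _ _ _ ⟩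
  Δ4-increment (10 + m) ℤ.+ Δ4-increment (5 + m) ℤ.+ Δ5-increment m
    ≡⟨ cong₂ (λ x y → x ℤ.+ y ℤ.+ Δ5-increment m)
             (periodic-+* {q = 2} {Δ4-increment} Δ4-increment-periodic 5 m)
             (periodic-+* {q = 2} {Δ4-increment} Δ4-increment-periodic 2 (1 + m)) ⟩
  Δ4-increment m ℤ.+ Δ4-increment (1 + m) ℤ.+ Δ5-increment m
    ≡⟨ cong (λ x → x ℤ.+ Δ5-increment m) (Δ4-increment-adjacent m) ⟩
  + 1 ℤ.+ Δ5-increment m ∎
  where open ≡-Reasoning

opaque
  unfolding Δ

  Δ5-increment-window : ∀ {r} → r < 12 → + 0 ≤ℤ Δ5-increment r
  Δ5-increment-window = from-yes (allUpTo? (λ r → + 0 ℤ.≤? Δ5-increment r) 12)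

  Δ5-window-from-2 : ∀ {r} → r < 10 → + 0 ≤ℤ Δ 5 (2 + r)
  Δ5-window-from-2 = from-yes (allUpTo? (λ r → + 0 ℤ.≤? Δ 5 (2 + r)) 10)

  Δ5-window-from-14 : ∀ {r} → r < 10 → + 1 ≤ℤ Δ 5 (14 + r)
  Δ5-window-from-14 = from-yes (allUpTo? (λ r → + 1 ℤ.≤? Δ 5 (14 + r)) 10)

Δ5-increment-nonneg : ∀ m → + 0 ≤ℤ Δ5-increment m
Δ5-increment-nonneg m = lower-bound-propagates 0 12
  (λ m _ → ℤ.≤-trans (ℤ.i≤j+i _ (+ 1)) (ℤ.≤-reflexive (sym (Δ5-increment-step m))))
  Δ5-increment-window m z≤n

Δ5-monotone : ∀ m → Δ 5 m ≤ℤ Δ 5 (10 + m)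
Δ5-monotone m = ℤ.≤-trans (≤-+-nonneg (Δ5-increment-nonneg m)) (ℤ.≤-reflexive (sym (Δ5-step m)))

Δ5-nonneg : ∀ n → 2 ≤ n → + 0 ≤ℤ Δ 5 n
Δ5-nonneg = lower-bound-propagates 2 10 (λ m _ → Δ5-monotone m)
  Δ5-window-from-2

Δ5-positive : ∀ n → 14 ≤ n → + 1 ≤ℤ Δ 5 n
Δ5-positive = lower-bound-propagates 14 10 (λ m _ → Δ5-monotone m)
  Δ5-window-from-14

opaque
  unfolding Δ

  Δ6-window-from-14 : ∀ {r} → r < 6 → + 0 ≤ℤ Δ 6 (14 + r)
  Δ6-window-from-14 = from-yes (allUpTo? (λ r → + 0 ℤ.≤? Δ 6 (14 + r)) 6)

Δ6-nonneg : ∀ n → 14 ≤ n → + 0 ≤ℤ Δ 6 n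
Δ6-nonneg = lower-bound-propagates 14 6
  (λ m _ → ℤ.≤-trans (≤-+-nonneg (Δ5-nonneg (6 + m) (s≤s (s≤s z≤n)))) (ℤ.≤-reflexive (sym (Δ-above 4 m))))
  Δ6-window-from-14

SignProfile : ℕ → Set
SignProfile K = (∀ n → 2 ≤ n → + 0 ≤ℤ Δ K n) × (∀ n → 8 ≤ n → n ≢ suc K → + 1 ≤ℤ Δ K n)

opaque
  unfolding Δ

  Δ7-window-from-9 : ∀ {r} → r < 7 → + 1 ≤ℤ Δ 7 (9 + r)
  Δ7-window-from-9 = from-yes (allUpTo? (λ r → + 1 ℤ.≤? Δ 7 (9 + r)) 7)

  Δ7-below-9 : ∀ {n} → n < 9 → 2 ≤ n → + 0 ≤ℤ Δ 7 n
  Δ7-below-9 = from-yes (allUpTo? (λ n → (2 ≤? n) →-dec (+ 0 ℤ.≤? Δ 7 n)) 9)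

Δ7-positive : ∀ n → 9 ≤ n → + 1 ≤ℤ Δ 7 n
Δ7-positive = lower-bound-propagates 9 7
  (λ m 9≤m → ℤ.≤-trans (≤-+-nonneg (Δ6-nonneg (7 + m) (+-monoʳ-≤ 7 (≤-trans (m≤n+m 7 2) 9≤m))))
                       (ℤ.≤-reflexive (sym (Δ-above 5 m))))
  Δ7-window-from-9

signProfile-7 : SignProfile 7
signProfile-7 = nonneg , λ n 8≤n n≢8 → Δ7-positive n (≤∧≢⇒< 8≤n (n≢8 ∘ sym))
  where
  nonneg : ∀ n → 2 ≤ n → + 0 ≤ℤ Δ 7 n
  nonneg n 2≤n with n <? 9
  ... | yes n<9 = Δ7-below-9 n<9 2≤n
  ... | no  n≮9 = ℤ.≤-trans (+≤+ z≤n) (Δ7-positive n (≮⇒≥ n≮9))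

signProfile-step : ∀ k → 6 ≤ k → SignProfile (1 + k) → SignProfile (2 + k)
signProfile-step k 6≤k (nonneg , positive) = nonneg′ , positive′
  where
  8≤2+k+ : ∀ m → 8 ≤ 2 + k + m
  8≤2+k+ m = ≤-trans (s≤s (s≤s 6≤k)) (m≤m+n (2 + k) m)
  beyond : ∀ m → 0 < m → 2 + k + m ≢ 2 + k
  beyond m 0<m = >⇒≢ (m<m+n (2 + k) 0<m)
  nonneg′ : ∀ n → 2 ≤ n → + 0 ≤ℤ Δ (2 + k) n
  nonneg′ = <-rec _ step
    where
    step : ∀ n → (∀ {m} → m < n → 2 ≤ m → + 0 ≤ℤ Δ (2 + k) m) → 2 ≤ n → + 0 ≤ℤ Δ (2 + k) n
    step n rec 2≤n with below-or-above (2 + k) n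
    ... | inj₁ n<2+k = subst (λ x → + 0 ≤ℤ x) (sym (Δ-below k n n<2+k)) (nonneg n 2≤n)
    ... | inj₂ (zero , refl) rewrite Δ-above k 0 | Δ-at-0 (suc k) =
      ℤ.+-mono-≤ (nonneg _ (s≤s (s≤s z≤n))) (+≤+ z≤n)
    ... | inj₂ (suc zero , refl) rewrite Δ-above k 1 | Δ-at-1 (suc k) =
      ℤ.+-mono-≤ (positive _ (8≤2+k+ 1) (beyond 1 z<s)) (ℤ.≤-refl { - + 1})
    ... | inj₂ (suc (suc m) , refl) rewrite Δ-above k (2 + m) =
      ℤ.+-mono-≤ (nonneg _ (s≤s (s≤s z≤n))) (rec (m<n+m (2 + m) {2 + k} z<s) (s≤s (s≤s z≤n)))
  positive′ : ∀ n → 8 ≤ n → n ≢ suc (2 + k) → + 1 ≤ℤ Δ (2 + k) n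
  positive′ n 8≤n n≢3+k with below-or-above (2 + k) n
  ... | inj₁ n<2+k = subst (λ x → + 1 ≤ℤ x) (sym (Δ-below k n n<2+k)) (positive n 8≤n (<⇒≢ n<2+k))
  ... | inj₂ (zero , refl) rewrite Δ-above k 0 | Δ-at-0 (suc k) =
    ℤ.+-mono-≤ (nonneg _ (s≤s (s≤s z≤n))) (ℤ.≤-refl {+ 1})
  ... | inj₂ (suc zero , refl) = contradiction (+-comm (2 + k) 1) n≢3+k
  ... | inj₂ (suc (suc m) , refl) rewrite Δ-above k (2 + m) =
    ℤ.+-mono-≤ (positive _ (8≤2+k+ (2 + m)) (beyond (2 + m) z<s)) (nonneg′ (2 + m) (s≤s (s≤s z≤n)))

signProfile : ∀ j → SignProfile (7 + j)
signProfile zero    = signProfile-7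
signProfile (suc j) = signProfile-step (6 + j) (m≤m+n 6 j) (signProfile j)

≤Δ⇒≤d : ∀ {c k} → 0 < k → ∀ n → c ≤ℤ Δ k n → c ≤ℤ d k n
≤Δ⇒≤d {c} 0<k n = subst (λ x → c ≤ℤ x) (sym (d≡Δ 0<k n))

d-large-k : ∀ k → 7 ≤ k →
  ((n : ℕ) → 2 ≤ n → + 0 ≤ℤ d k n) × (+ 1 ≤ℤ d k (k + 2)) × (+ 1 ≤ℤ d k (2 * k + 7))
d-large-k k 7≤k =
  (λ n 2≤n → fromΔ n (nonneg n 2≤n)) , fromΔ _ (beyond (k + 2) 1+k<k+2) , fromΔ _ (beyond (2 * k + 7) 1+k<2k+7)
  where
  profile : SignProfile k
  profile = let (j , 7+j≡k) = m≤n⇒∃[o]m+o≡n 7≤k in subst SignProfile 7+j≡k (signProfile j)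
  nonneg : ∀ n → 2 ≤ n → + 0 ≤ℤ Δ k n
  nonneg = proj₁ profile
  fromΔ : ∀ {c} n → c ≤ℤ Δ k n → c ≤ℤ d k n
  fromΔ = ≤Δ⇒≤d (≤-trans (s≤s z≤n) 7≤k)
  beyond : ∀ n → suc k < n → + 1 ≤ℤ Δ k n
  beyond n 1+k<n = proj₂ profile n (≤-trans (s≤s 7≤k) (<⇒≤ 1+k<n)) (>⇒≢ 1+k<n)
  1+k<k+2 : suc k < k + 2
  1+k<k+2 = ≤-reflexive (+-comm 2 k)
  1+k<2k+7 : suc k < 2 * k + 7
  1+k<2k+7 = subst (_≤ 2 * k + 7) (+-comm k 2) (+-mono-≤ (m≤m+n k (k + 0)) (s≤s (s≤s z≤n)))

theorem2p4 :
    ((n : ℕ) → (n % 2 ≡ 0 → d 2 n ≡ + 1) × (n % 2 ≡ 1 → d 2 n ≡ - (+ 1)))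
    × ((n : ℕ) → ((n % 6 ≡ 0) → d 3 n ≡ + 1) × ((n % 6 ≡ 2) → d 3 n ≡ + 1)
        × ((n % 6 ≡ 1) → d 3 n ≡ - (+ 1))
        × ((n % 6 ≡ 3) → d 3 n ≡ + 0) × ((n % 6 ≡ 4) → d 3 n ≡ + 0) × ((n % 6 ≡ 5) → d 3 n ≡ + 0))
    × ((n : ℕ) → (n % 2 ≡ 0 → + 0 ≤ℤ d 4 n)
        × (n % 2 ≡ 1 → n % 12 ≢ 3 → d 4 n ≡ - (+ ((n + 11) / 12)))
        × (n % 12 ≡ 3 → d 4 n ≡ - (+ (n / 12))))
    × ((n : ℕ) → (2 ≤ n → + 0 ≤ℤ d 5 n) × (14 ≤ n → + 1 ≤ℤ d 5 n))
    × ((n : ℕ) → 14 ≤ n → + 0 ≤ℤ d 6 n)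
    × ((k : ℕ) → 7 ≤ k →
        ((n : ℕ) → 2 ≤ n → + 0 ≤ℤ d k n) × (+ 1 ≤ℤ d k (k + 2)) × (+ 1 ≤ℤ d k (2 * k + 7)))
theorem2p4 =
    d2-by-parity
  , d3-by-residue
  , (λ n → d4-even n , d4-odd n , d4-three n)
  , (λ n → (λ 2≤n → ≤Δ⇒≤d z<s n (Δ5-nonneg n 2≤n)) , (λ 14≤n → ≤Δ⇒≤d z<s n (Δ5-positive n 14≤n)))
  , (λ n 14≤n → ≤Δ⇒≤d z<s n (Δ6-nonneg n 14≤n))
  , d-large-k
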